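{- For every pair of even integers $m,n$ with $3\leq m\leq n$, $\chi_{lid}(C_m\square C_n)=3$.
   Context: $C_n$ denotes the cycle on $n$ vertices. A proper $k$-coloring of a graph $G$ is a map $f:V(G)\to\{1,\dots,k\}$ with $f(u)\neq f(v)$ for every edge $uv$. For a vertex $v$, $N[v]$ denotes its closed neighborhood, and $f(S)=\{f(x):x\in S\}$. A lid-coloring of $G$ is a proper coloring $f$ such that for every edge $uv$ with $N[u]\neq N[v]$ we have $f(N[u])\neq f(N[v])$; $\chi_{lid}(G)$ is the smallest number of colors in a lid-coloring of $G$. The Cartesian product $G\square H$ has vertex set $V(G)\times V(H)$, where $(u_1,v_1)$ and $(u_2,v_2)$ are adjacent iff either $u_1=u_2$ and $v_1v_2\in E(H)$, or $v_1=v_2$ and $u_1u_2\in E(G)$. -}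

module Defs where

open import Data.Nat using (ℕ; zero; suc; _<_)
open import Data.Fin using (Fin; toℕ)
open import Data.Product using (Σ; _×_; ∃)
open import Data.Sum using (_⊎_)
open import Relation.Nullary using (¬_)
open import Relation.Binary.PropositionalEquality using (_≡_; _≢_)

record Graph : Set₁ where
  field
    V   : Set
    Adj : V → V → Set
open Graph public

CycSucc : (n : ℕ) → Fin n → Fin n → Set
CycSucc n i j = (suc (toℕ i) ≡ toℕ j) ⊎ ((suc (toℕ i) ≡ n) × (toℕ j ≡ 0))

Cycle : ℕ → Graph
Cycle n = record { V = Fin n ; Adj = λ i j → CycSucc n i j ⊎ CycSucc n j i }

_□_ : Graph → Graph → Graph
G □ H = record
  { V   = V G × V H
  ; Adj = λ p q → ((Σ.proj₁ p ≡ Σ.proj₁ q) × Adj H (Σ.proj₂ p) (Σ.proj₂ q))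
                ⊎ ((Σ.proj₂ p ≡ Σ.proj₂ q) × Adj G (Σ.proj₁ p) (Σ.proj₁ q))
  }
  where open import Data.Product using (module Σ)

N[_] : {G : Graph} → V G → V G → Set
N[_] {G} u x = (x ≡ u) ⊎ Adj G u x

SameSet : {A : Set} → (A → Set) → (A → Set) → Set
SameSet {A} P Q = (x : A) → (P x → Q x) × (Q x → P x)

Image : {A B : Set} → (A → B) → (A → Set) → B → Set
Image {A} f S c = Σ A (λ x → S x × (f x ≡ c))

-- Proper k-colouring (colours Fin k ≅ {1,…,k}).
IsProper : (G : Graph) (k : ℕ) → (V G → Fin k) → Set
IsProper G k f = (u v : V G) → Adj G u v → f u ≢ f v

IsLid : (G : Graph) (k : ℕ) → (V G → Fin k) → Set
IsLid G k f = IsProper G k f ×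
  ((u v : V G) → Adj G u v → ¬ SameSet (N[_] {G} u) (N[_] {G} v) →
     ¬ SameSet (Image f (N[_] {G} u)) (Image f (N[_] {G} v)))

χlid≡ : Graph → ℕ → Set
χlid≡ G k = Σ (V G → Fin k) (IsLid G k) ×
            ((j : ℕ) → j < k → ¬ Σ (V G → Fin j) (IsLid G j))

-- Lower bound: any graph with an induced path w – u – v needs three colours, since with at most
-- two colours a properly coloured edge uv sees both colours in N[u] and in N[v].
-- Upper bound: colour (i , j) by 0 when i and j have the same parity and by 1 or 2 otherwise,
-- according to the parity of i. A vertex u of colour 0 sees both colours 1 and 2 among its
-- neighbours, while every neighbour v of u has only neighbours of colour 0, so f(N[v]) has two
-- elements and f(N[u]) three. The argument works for any product of two bipartite graphs
-- without isolated vertices.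
module Submission where

open import Defs
open import Data.Nat using (ℕ; zero; suc; _≤_; _<_; s≤s; parity)
open import Data.Nat.Properties using (_<?_; ≤-antisym; ≮⇒≥; ≤-trans)
open import Data.Nat.Divisibility using (_∣_; divides)
open import Data.Fin using (Fin; toℕ; fromℕ<) renaming (zero to fz; suc to fs)
open import Data.Fin.Properties using (toℕ<n; toℕ-fromℕ<; _≟_)
open import Data.Parity using (Parity; 0ℙ; 1ℙ; _⁻¹; _+_)
open import Data.Parity.Properties
  using (⁻¹-selfInverse; ⁻¹-involutive; suc-homo-⁻¹; *-homo-*; *-zeroʳ)
open import Data.Product using (Σ; _×_; _,_; proj₁; swap)
open import Data.Sum using (_⊎_; inj₁; inj₂; [_,_])
open import Function using (_∘_)
open import Relation.Nullary using (¬_; Dec; yes; no; contradiction)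
open import Relation.Binary.PropositionalEquality
  using (_≡_; _≢_; refl; sym; trans; cong; subst₂; module ≡-Reasoning)

record InducedPath₃ (G : Graph) : Set where
  field
    u v w   : V G
    u~v     : Adj G u v
    v~u     : Adj G v u
    u~w     : Adj G u w
    w∉N[v]  : ¬ N[_] {G} v w

Fin2-cover : {a b : Fin 2} → a ≢ b → (c : Fin 2) → c ≡ a ⊎ c ≡ b
Fin2-cover {fz}    {fz}    a≢b _       = contradiction refl a≢b
Fin2-cover {fs fz} {fs fz} a≢b _       = contradiction refl a≢b
Fin2-cover {fz}    {fs fz} _   fz      = inj₁ refl
Fin2-cover {fz}    {fs fz} _   (fs fz) = inj₂ refl
Fin2-cover {fs fz} {fz}    _   fz      = inj₂ refl
Fin2-cover {fs fz} {fz}    _   (fs fz) = inj₁ refl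

module _ {G : Graph} where

  image-N[]-full : {u v : V G} (f : V G → Fin 2) → f u ≢ f v →
                   Adj G u v → Adj G v u → (c : Fin 2) →
                   Image f (N[_] {G} u) c × Image f (N[_] {G} v) c
  image-N[]-full f fu≢fv u~v v~u c with Fin2-cover fu≢fv c
  ... | inj₁ refl = (_ , inj₁ refl , refl) , (_ , inj₂ v~u , refl)
  ... | inj₂ refl = (_ , inj₂ u~v , refl) , (_ , inj₁ refl , refl)

  module _ (P : InducedPath₃ G) where
    open InducedPath₃ P

    lid-needs-three-colours : (k : ℕ) → k < 3 → ¬ Σ (V G → Fin k) (IsLid G k)
    lid-needs-three-colours zero _ (f , _) with f u
    ... | ()
    lid-needs-three-colours (suc zero) _ (f , proper , _) with f u | f v | proper u v u~v
    ... | fz | fz | fu≢fv = fu≢fv refl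
    lid-needs-three-colours (suc (suc zero)) _ (f , proper , separates) =
      separates u v u~v
        (λ same → w∉N[v] (proj₁ (same w) (inj₂ u~w)))
        (λ c → let (inU , inV) = image-N[]-full f (proper u v u~v) u~v v~u c
               in (λ _ → inV) , (λ _ → inU))
    lid-needs-three-colours (suc (suc (suc _))) (s≤s (s≤s (s≤s ())))

parity-suc : ∀ n → parity (suc n) ≡ parity n ⁻¹
parity-suc n = sym (⁻¹-selfInverse (suc-homo-⁻¹ n))

parity-even : ∀ {n} → 2 ∣ n → parity n ≡ 0ℙ
parity-even (divides k refl) = trans (*-homo-* k 2) (*-zeroʳ (parity k))

⁻¹-+ : ∀ p q → p ⁻¹ + q ≡ (p + q) ⁻¹
⁻¹-+ 0ℙ q = refl
⁻¹-+ 1ℙ q = sym (⁻¹-involutive q)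

+-⁻¹ : ∀ p q → p + q ⁻¹ ≡ (p + q) ⁻¹
+-⁻¹ 0ℙ q = refl
+-⁻¹ 1ℙ q = refl

IsBipartition : (G : Graph) → (V G → Parity) → Set
IsBipartition G side = ∀ x y → Adj G x y → side y ≡ side x ⁻¹

NoIsolatedVertex : Graph → Set
NoIsolatedVertex G = ∀ x → Σ (V G) (Adj G x)

cycSucc-flips-parity : ∀ {n} → 2 ∣ n → (i j : Fin n) → CycSucc n i j →
                       parity (toℕ j) ≡ parity (toℕ i) ⁻¹
cycSucc-flips-parity _   i j (inj₁ i+1≡j) =
  trans (cong parity (sym i+1≡j)) (parity-suc (toℕ i))
cycSucc-flips-parity {n} 2∣n i j (inj₂ (i+1≡n , j≡0)) = begin
  parity (toℕ j)        ≡⟨ cong parity j≡0 ⟩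
  0ℙ                    ≡⟨ sym (parity-even 2∣n) ⟩
  parity n              ≡⟨ cong parity (sym i+1≡n) ⟩
  parity (suc (toℕ i))  ≡⟨ parity-suc (toℕ i) ⟩
  parity (toℕ i) ⁻¹     ∎
  where open ≡-Reasoning

cycle-bipartition : ∀ {n} → 2 ∣ n → IsBipartition (Cycle n) (parity ∘ toℕ)
cycle-bipartition 2∣n i j (inj₁ i→j) = cycSucc-flips-parity 2∣n i j i→j
cycle-bipartition 2∣n i j (inj₂ j→i) =
  sym (⁻¹-selfInverse (sym (cycSucc-flips-parity 2∣n j i j→i)))

cycle-successor : ∀ {n} (i : Fin n) → Σ (Fin n) (CycSucc n i)
cycle-successor {suc n} i with suc (toℕ i) <? suc n
... | yes i+1<n = fromℕ< i+1<n , inj₁ (sym (toℕ-fromℕ< i+1<n))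
... | no  i+1≮n = fz , inj₂ (≤-antisym (toℕ<n i) (≮⇒≥ i+1≮n) , refl)

cycle-noIsolatedVertex : ∀ n → NoIsolatedVertex (Cycle n)
cycle-noIsolatedVertex n i = let (j , i→j) = cycle-successor i in j , inj₁ i→j

colour : Parity → Parity → Fin 3
colour 0ℙ 0ℙ = fz
colour 1ℙ 1ℙ = fz
colour 0ℙ 1ℙ = fs fz
colour 1ℙ 0ℙ = fs (fs fz)

colour-even : ∀ {p q} → p + q ≡ 0ℙ → colour p q ≡ fz
colour-even {0ℙ} {0ℙ} _ = refl
colour-even {1ℙ} {1ℙ} _ = refl

colour-odd : ∀ {p q} → p + q ≡ 1ℙ → colour p q ≢ fz
colour-odd {0ℙ} {1ℙ} _ ()
colour-odd {1ℙ} {0ℙ} _ ()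

colour-proper : ∀ {p q p′ q′} → p′ + q′ ≡ (p + q) ⁻¹ → colour p q ≢ colour p′ q′
colour-proper {p} {q} flips with p + q in pq
... | 0ℙ = λ same → colour-odd flips (trans (sym same) (colour-even pq))
... | 1ℙ = λ same → colour-odd pq (trans same (colour-even flips))

colour-flips-distinct : ∀ {p q} → p + q ≡ 0ℙ → colour (p ⁻¹) q ≢ colour p (q ⁻¹)
colour-flips-distinct {0ℙ} {0ℙ} _ ()
colour-flips-distinct {1ℙ} {1ℙ} _ ()

module ProductColouring {G H : Graph}
  (p : V G → Parity) (p-bip : IsBipartition G p) (G-noIso : NoIsolatedVertex G)
  (q : V H → Parity) (q-bip : IsBipartition H q) (H-noIso : NoIsolatedVertex H)
  where

  G□H : Graph
  G□H = G □ H

  side : V G□H → Parity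
  side (x , y) = p x + q y

  col : V G□H → Fin 3
  col (x , y) = colour (p x) (q y)

  side-flips : IsBipartition G□H side
  side-flips (x , y) (.x , y′) (inj₁ (refl , y~y′)) =
    trans (cong (p x +_) (q-bip y y′ y~y′)) (+-⁻¹ (p x) (q y))
  side-flips (x , y) (x′ , .y) (inj₂ (refl , x~x′)) =
    trans (cong (_+ q y) (p-bip x x′ x~x′)) (⁻¹-+ (p x) (q y))

  col-proper : IsProper G□H 3 col
  col-proper u v u~v = colour-proper (side-flips u v u~v)

  colours-around-odd : ∀ {v c} → side v ≡ 1ℙ → Image col (N[_] {G□H} v) c → c ≡ col v ⊎ c ≡ fz
  colours-around-odd odd (_ , inj₁ refl   , refl) = inj₁ refl
  colours-around-odd {v} odd (x , inj₂ v~x , refl) =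
    inj₂ (colour-even (trans (side-flips v x v~x) (cong _⁻¹ odd)))

  -- The two neighbours reached by moving in G and in H carry the two nonzero colours.
  even-avoids-colour : ∀ {u} → side u ≡ 0ℙ → (c : Fin 3) →
                       Σ (V G□H) λ w → Adj G□H u w × col w ≢ c × col w ≢ fz
  even-avoids-colour {x , y} even c with G-noIso x | H-noIso y
  ... | x′ , x~x′ | y′ , y~y′ = pick (col w₁ ≟ c)
    where
    w₁ w₂ : V G□H
    w₁ = x′ , y
    w₂ = x , y′

    u~w₁ : Adj G□H (x , y) w₁
    u~w₁ = inj₂ (refl , x~x′)

    u~w₂ : Adj G□H (x , y) w₂
    u~w₂ = inj₁ (refl , y~y′)

    nonzero : ∀ w → Adj G□H (x , y) w → col w ≢ fz
    nonzero w u~w = colour-odd (trans (side-flips (x , y) w u~w) (cong _⁻¹ even))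

    distinct : col w₁ ≢ col w₂
    distinct = subst₂ (λ a b → colour a (q y) ≢ colour (p x) b)
                 (sym (p-bip x x′ x~x′)) (sym (q-bip y y′ y~y′)) (colour-flips-distinct even)

    pick : Dec (col w₁ ≡ c) → Σ (V G□H) λ w → Adj G□H (x , y) w × col w ≢ c × col w ≢ fz
    pick (yes refl) = w₂ , u~w₂ , distinct ∘ sym , nonzero w₂ u~w₂
    pick (no w₁≢c)  = w₁ , u~w₁ , w₁≢c , nonzero w₁ u~w₁

  even-separates : ∀ {u v} → side u ≡ 0ℙ → side v ≡ 1ℙ →
                   ¬ SameSet (Image col (N[_] {G□H} u)) (Image col (N[_] {G□H} v))
  even-separates {v = v} even odd same =
    let (w , u~w , w≢v , w≢0) = even-avoids-colour even (col v)
    in [ w≢v , w≢0 ] (colours-around-odd odd (proj₁ (same (col w)) (w , inj₂ u~w , refl)))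

  col-lid : IsLid G□H 3 col
  col-lid = col-proper , separates
    where
    separates : ∀ u v → Adj G□H u v → ¬ SameSet (N[_] {G□H} u) (N[_] {G□H} v) →
                ¬ SameSet (Image col (N[_] {G□H} u)) (Image col (N[_] {G□H} v))
    separates u v u~v _ with side u in su
    ... | 0ℙ = even-separates su (trans (side-flips u v u~v) (cong _⁻¹ su))
    ... | 1ℙ = λ same → even-separates (trans (side-flips u v u~v) (cong _⁻¹ su)) su
                                       (λ x → swap (same x))

torus-inducedPath₃ : ∀ {m n} → 3 ≤ m → 3 ≤ n → InducedPath₃ (Cycle m □ Cycle n)
torus-inducedPath₃ (s≤s (s≤s (s≤s _))) (s≤s (s≤s (s≤s _))) = record
  { u      = fz , fz
  ; v      = fz , fs fz
  ; w      = fs fz , fz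
  ; u~v    = inj₁ (refl , inj₁ (inj₁ refl))
  ; v~u    = inj₁ (refl , inj₂ (inj₁ refl))
  ; u~w    = inj₂ (refl , inj₁ (inj₁ refl))
  ; w∉N[v] = λ { (inj₁ ()) ; (inj₂ (inj₁ (() , _))) ; (inj₂ (inj₂ (() , _))) }
  }

lemma7 : (m n : ℕ) → 2 ∣ m → 2 ∣ n → 3 ≤ m → m ≤ n →
    χlid≡ (Cycle m □ Cycle n) 3
lemma7 m n 2∣m 2∣n 3≤m m≤n =
  (col , col-lid) , lid-needs-three-colours (torus-inducedPath₃ 3≤m (≤-trans 3≤m m≤n))
  where
  open ProductColouring
    (parity ∘ toℕ) (cycle-bipartition 2∣m) (cycle-noIsolatedVertex m)
    (parity ∘ toℕ) (cycle-bipartition 2∣n) (cycle-noIsolatedVertex n)
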